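{- Let $G=(V,E)$ be a strongly connected $d$-out digraph with period $\mathrm{per}(G)=t$, let $S$ be a coloring semigroup of $G$, and let $Q(G)$ be the quotient graph of $G$ induced by the stability classes of $S$. Then $\mathrm{per}(Q(G))=t$.
   Context: A $d$-out digraph has every vertex of out-degree $d$ (multiple edges allowed). A coloring is a decomposition of the adjacency matrix $\mathcal A=R_1+\cdots+R_d$ into 0-1 stochastic matrices, each identified with a map $V\to V$ ($jR_i=k$ iff $(R_i)_{jk}=1$; maps act on the right); the coloring semigroup $S$ is the semigroup they generate. The stability relation: $x\equiv_S y$ iff for every $W_1\in S$ there is $W_2\in S$ with $xW_1W_2=yW_1W_2$; it is a congruence (compatible with the colored edges). The quotient graph $Q(G)$ has as vertices the stability classes $[v]$, with an edge $[v]\to[w]$ for each edge $v\to w$ of $G$. The period $\mathrm{per}$ of a strongly connected digraph is the largest $t$ such that $V$ admits a partition $\{P_1,\ldots,P_t\}$ with every edge from $P_k$ ending in $P_{k+1}$ (indices mod $t$), equivalently the gcd of the lengths of its cycles; $\mathrm{per}=1$ means aperiodic. -}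

module Defs where

open import Data.Nat using (ℕ; zero; suc; _<_; _≤_)
open import Data.Fin using (Fin)
open import Data.List using (List; []; _∷_; foldl)
open import Data.List.NonEmpty using (List⁺; toList)
open import Data.Product using (Σ; ∃; _×_; _,_)
open import Data.Sum using (_⊎_)
open import Relation.Binary.PropositionalEquality using (_≡_)

-- A colored d-out digraph on vertex set Fin n: the coloring A = R_1 + ... + R_d
-- is given by the d maps R i : Fin n → Fin n (vertex v has, for each colour i,
-- exactly one outgoing edge v → R i v; multiple edges allowed).
Coloring : ℕ → ℕ → Set
Coloring n d = Fin d → Fin n → Fin n

module _ {n d : ℕ} (R : Coloring n d) where

  act : Fin n → List (Fin d) → Fin n
  act = foldl (λ v i → R i v)

  -- action of an element of the coloring semigroup S (nonempty words)
  actS : Fin n → List⁺ (Fin d) → Fin n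
  actS v w = act v (toList w)

  Edge : Fin n → Fin n → Set
  Edge u v = ∃ λ (i : Fin d) → R i u ≡ v

  StronglyConnected : Set
  StronglyConnected = ∀ (u v : Fin n) → ∃ λ (w : List (Fin d)) → act u w ≡ v

  Stable : Fin n → Fin n → Set
  Stable x y = ∀ (W₁ : List⁺ (Fin d)) → ∃ λ (W₂ : List⁺ (Fin d)) →
                 actS (actS x W₁) W₂ ≡ actS (actS y W₁) W₂

  -- f labels parts P_0,...,P_{t-1} of a partition into t (nonempty) parts
  -- such that every edge from P_k ends in P_{k+1 mod t}
  CyclicLabel : ℕ → (Fin n → ℕ) → Set
  CyclicLabel t f =
      (∀ v → f v < t)
    × (∀ k → k < t → ∃ λ v → f v ≡ k)
    × (∀ u v → Edge u v → (f v ≡ suc (f u)) ⊎ (suc (f u) ≡ t × f v ≡ 0))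

  HasCyclicPartition : ℕ → Set
  HasCyclicPartition t = ∃ λ f → CyclicLabel t f

  Period : ℕ → Set
  Period t = HasCyclicPartition t × (∀ t' → HasCyclicPartition t' → t' ≤ t)

  -- Quotient graph Q(G): vertices are stability classes [v], an edge [u] → [v]
  -- for each edge u → v of G.  A partition of the vertices of Q(G) is the same
  -- as a labelling of Fin n constant on stability classes; the edge condition
  -- on Q(G) is the condition on the representing edges of G.
  HasCyclicPartitionQ : ℕ → Set
  HasCyclicPartitionQ t = ∃ λ f → CyclicLabel t f × (∀ x y → Stable x y → f x ≡ f y)

  PeriodQ : ℕ → Set
  PeriodQ t = HasCyclicPartitionQ t × (∀ t' → HasCyclicPartitionQ t' → t' ≤ t)

module Submission where

-- Let f label a cyclic partition of G into t = per(G) parts.  An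
-- edge u → v moves the label by the cyclic successor k ↦ k+1 (mod t), which is
-- an injective map; hence a word w moves every label by the same injective map,
-- and two vertices sent to the same vertex by some word carry the same label.
-- If x ≡_S y, then x W₁ W₂ = y W₁ W₂ for some words (take any one-letter W₁),
-- so f x = f y: the labelling f is constant on stability classes and therefore
-- is a cyclic partition of Q(G) with t parts, giving per(Q(G)) ≥ t.
-- Conversely every cyclic partition of Q(G) is one of G, so per(Q(G)) ≤ t.

open import Defs
open import Data.Nat using (ℕ; zero; suc; _≤_; _≟_)
open import Data.Nat.Properties using (suc-injective; <-irrefl)
open import Data.Fin using (Fin)
open import Data.List using ([]; _∷_)
open import Data.List.NonEmpty using (toList; _∷_)
open import Data.Product using (_,_; proj₁; proj₂)
open import Data.Sum using (inj₁; inj₂)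
open import Data.Empty using (⊥-elim)
open import Relation.Nullary using (yes; no)
open import Relation.Binary.PropositionalEquality using (_≡_; refl; sym; trans; cong)

cyclicSucc : ℕ → ℕ → ℕ
cyclicSucc t k with suc k ≟ t
... | yes _ = 0
... | no _  = suc k

cyclicSucc-injective : ∀ t {a b} → cyclicSucc t a ≡ cyclicSucc t b → a ≡ b
cyclicSucc-injective t {a} {b} eq with suc a ≟ t | suc b ≟ t | eq
... | yes a+1≡t | yes b+1≡t | _    = suc-injective (trans a+1≡t (sym b+1≡t))
... | no _      | no _      | refl = refl

module CyclicLabelling {n d : ℕ} (R : Coloring n d) {t : ℕ} {f : Fin n → ℕ}
                       (cl : CyclicLabel R t f) where

  label-edge : ∀ i u → f (R i u) ≡ cyclicSucc t (f u)
  label-edge i u with suc (f u) ≟ t | proj₂ (proj₂ cl) u (R i u) (i , refl)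
  ... | yes u+1≡t | inj₁ v≡u+1      = ⊥-elim (<-irrefl (trans v≡u+1 u+1≡t) (proj₁ cl (R i u)))
  ... | yes _     | inj₂ (_ , v≡0)  = v≡0
  ... | no _      | inj₁ v≡u+1      = v≡u+1
  ... | no u+1≢t  | inj₂ (u+1≡t , _) = ⊥-elim (u+1≢t u+1≡t)

  -- Each letter acts on labels by the injective cyclic successor, so the
  -- labels of x and y are equal as soon as those of x w and y w are.
  label-reflect : ∀ w {x y} → f (act R x w) ≡ f (act R y w) → f x ≡ f y
  label-reflect []      same = same
  label-reflect (i ∷ w) {x} {y} same =
    cyclicSucc-injective t
      (trans (sym (label-edge i x)) (trans (label-reflect w same) (label-edge i y)))

  -- With at least one colour c, a cyclic labelling is constant on stability
  -- classes: stability applied to the one-letter word c merges x and y.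
  label-stable-coloured : Fin d → ∀ x y → Stable R x y → f x ≡ f y
  label-stable-coloured c x y stable with stable (c ∷ [])
  ... | W₂ , merged = label-reflect (c ∷ []) (label-reflect (toList W₂) (cong f merged))

-- Without colours, a strongly connected graph has at most one vertex: the only
-- path from x to y is the empty one.
colourless-singleton : ∀ {n} (R : Coloring n 0) → StronglyConnected R → ∀ (x y : Fin n) → x ≡ y
colourless-singleton R sc x y with sc x y
... | [] , x≡y = x≡y
... | (() ∷ _) , _

label-stable : ∀ {n} d (R : Coloring n d) {t f} → CyclicLabel R t f →
               StronglyConnected R → ∀ x y → Stable R x y → f x ≡ f y
label-stable zero    R {f = f} _  sc x y _ = cong f (colourless-singleton R sc x y)
label-stable (suc _) R         cl _  x y stable =
  CyclicLabelling.label-stable-coloured R cl Fin.zero x y stable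

partitionQ⇒partition : ∀ {n d} (R : Coloring n d) {t} →
                       HasCyclicPartitionQ R t → HasCyclicPartition R t
partitionQ⇒partition R (f , cl , _) = f , cl

mainTheorem5 : (n d t : ℕ) (R : Coloring n d) →
    StronglyConnected R → Period R t → PeriodQ R t
mainTheorem5 n d t R sc ((f , cl) , maximal) = partitionQ , boundQ
  where
  partitionQ : HasCyclicPartitionQ R t
  partitionQ = f , cl , label-stable d R cl sc

  boundQ : ∀ t' → HasCyclicPartitionQ R t' → t' ≤ t
  boundQ t' hasQ = maximal t' (partitionQ⇒partition R hasQ)
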